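{- For any even integer $2q$ there are $2^{\frac{q}{2}(3q - 1)}$ combinations of edges which construct partially symmetric graphs having $2$ clusters with $q$ vertices in each.
   Context: A graph $G$ on $n = 2q$ vertices has its vertex set partitioned into two disjoint clusters $C_1 = \{v_{1,1}, \dots, v_{1,q}\}$ and $C_2 = \{v_{2,1}, \dots, v_{2,q}\}$. The partial transpose $G^\tau$ of this clustered graph is obtained by removing every existing edge $(v_{1,i}, v_{2,j})$ with $i \neq j$ and adding the corresponding edge $(v_{1,j}, v_{2,i})$; edges inside $C_1$, inside $C_2$, and edges $(v_{1,i}, v_{2,i})$ are unchanged. Two graphs on the same labelled vertex set are called equal if the identity map is an isomorphism. A graph $G$ is partially symmetric if $G = G^\tau$. -}

module Defs where

open import Data.Bool using (Bool; true; false; if_then_else_)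
open import Data.Nat using (ℕ; _+_)
open import Data.Fin using (Fin; _↑ˡ_; _↑ʳ_; splitAt; _≟_)
open import Data.Sum using (inj₁; inj₂)
open import Data.Product using (_×_)
open import Data.Vec using (Vec; lookup; tabulate)
open import Relation.Nullary using (does)
open import Relation.Binary.PropositionalEquality using (_≡_)

-- Vertex set of the clustered graph: Fin (q + q).
-- Cluster C₁ = first q indices, cluster C₂ = last q indices.
v₁ : ∀ {q} → Fin q → Fin (q + q)
v₁ {q} i = i ↑ˡ q

v₂ : ∀ {q} → Fin q → Fin (q + q)
v₂ {q} i = q ↑ʳ i

-- A (labelled) graph on n vertices is given by its adjacency matrix.
Matrix : ℕ → Set
Matrix n = Vec (Vec Bool n) n

adj : ∀ {n} → Matrix n → Fin n → Fin n → Bool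
adj M u v = lookup (lookup M u) v

IsGraph : ∀ {n} → Matrix n → Set
IsGraph M = (∀ u v → adj M u v ≡ adj M v u) × (∀ u → adj M u u ≡ false)

-- Adjacency of the partial transpose G^τ:
--  (v₁ i , v₂ j) with i ≠ j is an edge of G^τ iff (v₁ j , v₂ i) is an edge of G,
--  (and symmetrically for (v₂ j , v₁ i)); all other adjacencies are unchanged.
τadj : ∀ {q} → Matrix (q + q) → Fin (q + q) → Fin (q + q) → Bool
τadj {q} M u v with splitAt q u | splitAt q v
... | inj₁ i | inj₂ j = if does (i ≟ j) then adj M u v else adj M (v₁ {q} j) (v₂ {q} i)
... | inj₂ j | inj₁ i = if does (i ≟ j) then adj M u v else adj M (v₂ {q} i) (v₁ {q} j)
... | inj₁ _ | inj₁ _ = adj M u v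
... | inj₂ _ | inj₂ _ = adj M u v

partialTranspose : ∀ {q} → Matrix (q + q) → Matrix (q + q)
partialTranspose {q} M = tabulate λ u → tabulate λ v → τadj {q} M u v

-- Partially symmetric: G equals G^τ on the same labelled vertex set
-- (identity map is an isomorphism, i.e. identical adjacency matrices).
PartiallySymmetric : (q : ℕ) → Matrix (q + q) → Set
PartiallySymmetric q M = M ≡ partialTranspose {q} M

IsPSGraph : (q : ℕ) → Matrix (q + q) → Set
IsPSGraph q M = IsGraph M × PartiallySymmetric q M

module Submission where

-- Order the adjacency matrix of a graph on C₁ ∪ C₂ into four q × q blocks.
-- The partial transpose only exchanges the cross entries (v₁ i, v₂ j) and
-- (v₁ j, v₂ i), so a graph is partially symmetric exactly when its cross block
-- is a symmetric matrix.  A partially symmetric graph is therefore the same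
-- thing as a triple of
--   * a symmetric loopless block on C₁   (its strict upper triangle: q(q-1)/2 bits),
--   * a symmetric loopless block on C₂   (q(q-1)/2 bits),
--   * a symmetric cross block            (diagonal plus triangle: q + q(q-1)/2 bits),
-- giving 2 ^ (3·q(q-1)/2 + q) = 2 ^ (q(3q-1)/2) graphs.

open import Defs
open import Data.Nat using (ℕ; _*_; _∸_; _^_; _/_; _+_)
open import Data.Product using (Σ; _×_)
open import Data.List using (List; length)
open import Data.List.Relation.Unary.Unique.Propositional using (Unique)
open import Data.List.Membership.Propositional using (_∈_)
open import Function.Bundles using (_⇔_)
open import Relation.Binary.PropositionalEquality using (_≡_)

open import Data.Nat using (zero; suc)
open import Data.Nat.Properties using (^-distribˡ-+-*; *-distribˡ-∸; *-identityʳ; m+n∸n≡m)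
open import Data.Nat.DivMod using (m*n/n≡m)
open import Data.Nat.Tactic.RingSolver using (solve-∀)
open import Data.Bool using (Bool; true; false)
open import Data.Unit using (⊤; tt)
open import Data.Fin using (Fin; zero; suc; splitAt; join)
open import Data.Fin.Properties using (splitAt-↑ˡ; splitAt-↑ʳ; splitAt-join; join-splitAt; _≟_)
open import Data.Sum using (_⊎_; inj₁; inj₂)
open import Data.Product using (_,_; proj₁; uncurry)
open import Data.List using ([]; _∷_; _++_; map; cartesianProduct)
open import Data.List.Properties using (length-++; length-map)
open import Data.List.Relation.Unary.Unique.Propositional.Properties using (map⁺; cartesianProduct⁺)
open import Data.List.Relation.Unary.Any using (here; there)
open import Data.List.Relation.Unary.All using ([]; _∷_)
open import Data.List.Relation.Unary.AllPairs using ([]; _∷_)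
open import Data.List.Membership.Propositional.Properties using (∈-map⁺; ∈-map⁻; ∈-cartesianProduct⁺)
open import Data.Vec using (Vec; []; _∷_; lookup; tabulate)
open import Data.Vec.Properties using (∷-injective; lookup∘tabulate; tabulate∘lookup; tabulate-cong)
open import Function.Bundles using (mk⇔; Equivalence)
open import Relation.Nullary using (yes; no)
open import Relation.Binary.PropositionalEquality using (refl; sym; trans; cong; cong₂; subst; subst₂; module ≡-Reasoning)

open ≡-Reasoning

record Enum (A : Set) (n : ℕ) : Set where
  field
    elems    : List A
    unique   : Unique elems
    complete : ∀ x → x ∈ elems
    size     : length elems ≡ n
open Enum

enumCast : ∀ {A m n} → m ≡ n → Enum A m → Enum A n
enumCast refl E = E

enum⊤ : Enum ⊤ 1
enum⊤ = record { elems = tt ∷ [] ; unique = [] ∷ [] ; complete = λ _ → here refl ; size = refl }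

enumBool : Enum Bool 2
enumBool = record
  { elems = true ∷ false ∷ [] ; unique = ((λ ()) ∷ []) ∷ [] ∷ []
  ; complete = λ { true → here refl ; false → there (here refl) } ; size = refl }

length-cartesianProduct : ∀ {A B : Set} (xs : List A) (ys : List B) →
                          length (cartesianProduct xs ys) ≡ length xs * length ys
length-cartesianProduct [] ys = refl
length-cartesianProduct (x ∷ xs) ys = begin
  length (map (x ,_) ys ++ cartesianProduct xs ys)
    ≡⟨ length-++ (map (x ,_) ys) ⟩
  length (map (x ,_) ys) + length (cartesianProduct xs ys)
    ≡⟨ cong₂ _+_ (length-map (x ,_) ys) (length-cartesianProduct xs ys) ⟩
  length ys + length xs * length ys ∎

enum× : ∀ {A B m n} → Enum A m → Enum B n → Enum (A × B) (m * n)
enum× EA EB = record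
  { elems    = cartesianProduct (elems EA) (elems EB)
  ; unique   = cartesianProduct⁺ (unique EA) (unique EB)
  ; complete = λ (x , y) → ∈-cartesianProduct⁺ (complete EA x) (complete EB y)
  ; size     = trans (length-cartesianProduct (elems EA) (elems EB)) (cong₂ _*_ (size EA) (size EB)) }

enumBits× : ∀ {A B} m n → Enum A (2 ^ m) → Enum B (2 ^ n) → Enum (A × B) (2 ^ (m + n))
enumBits× m n EA EB = enumCast (sym (^-distribˡ-+-* 2 m n)) (enum× EA EB)

enumVec : ∀ {A m} → Enum A m → ∀ k → Enum (Vec A k) (m ^ k)
enumVec E zero = record
  { elems = [] ∷ [] ; unique = [] ∷ [] ; complete = λ { [] → here refl } ; size = refl }
enumVec E (suc k) = record
  { elems    = map cons (elems pairs)
  ; unique   = map⁺ cons-injective (unique pairs)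
  ; complete = λ { (x ∷ xs) → ∈-map⁺ cons (complete pairs (x , xs)) }
  ; size     = trans (length-map cons (elems pairs)) (size pairs) }
  where
  pairs = enum× E (enumVec E k)
  cons : _ → Vec _ (suc k)
  cons = uncurry _∷_
  cons-injective : ∀ {p p'} → cons p ≡ cons p' → p ≡ p'
  cons-injective e = let (e₁ , e₂) = ∷-injective e in cong₂ _,_ e₁ e₂

listImage : ∀ {A B : Set} {n} (P : B → Set) → Enum A n → (build : A → B) (extract : B → A) →
            (∀ a → extract (build a) ≡ a) → (∀ a → P (build a)) → (∀ b → P b → build (extract b) ≡ b) →
            Σ (List B) λ L → Unique L × (∀ b → P b ⇔ b ∈ L) × (length L ≡ n)
listImage P E build extract retract sound rebuild =
    map build (elems E)
  , map⁺ build-injective (unique E)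
  , (λ b → mk⇔ (λ Pb → subst (_∈ map build (elems E)) (rebuild b Pb) (∈-map⁺ build (complete E (extract b))))
               (λ b∈ → let (a , _ , b≡) = ∈-map⁻ build b∈ in subst P (sym b≡) (sound a)))
  , trans (length-map build (elems E)) (size E)
  where
  build-injective : ∀ {a a'} → build a ≡ build a' → a ≡ a'
  build-injective {a} {a'} e = trans (sym (retract a)) (trans (cong extract e) (retract a'))

-- Symmetric Boolean q × q matrices.  A Triangle q stores the strict upper
-- triangle row by row; together with a diagonal it determines a symmetric matrix.
Triangle : ℕ → Set
Triangle zero    = ⊤
Triangle (suc q) = Vec Bool q × Triangle q

-- triangle q = q(q-1)/2, the number of entries strictly above the diagonal.
triangle : ℕ → ℕ
triangle zero    = 0
triangle (suc q) = q + triangle q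

enumTriangle : ∀ q → Enum (Triangle q) (2 ^ triangle q)
enumTriangle zero    = enum⊤
enumTriangle (suc q) = enumBits× q (triangle q) (enumVec enumBool q) (enumTriangle q)

symmetric : ∀ {q} → (Fin q → Bool) → Triangle q → Fin q → Fin q → Bool
symmetric δ (r , t) zero    zero    = δ zero
symmetric δ (r , t) zero    (suc j) = lookup r j
symmetric δ (r , t) (suc i) zero    = lookup r i
symmetric δ (r , t) (suc i) (suc j) = symmetric (λ k → δ (suc k)) t i j

upper : ∀ {q} → (Fin q → Fin q → Bool) → Triangle q
upper {zero}  f = tt
upper {suc q} f = tabulate (λ j → f zero (suc j)) , upper (λ i j → f (suc i) (suc j))

symmetric-sym : ∀ {q} δ (t : Triangle q) i j → symmetric δ t i j ≡ symmetric δ t j i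
symmetric-sym δ (r , t) zero    zero    = refl
symmetric-sym δ (r , t) zero    (suc j) = refl
symmetric-sym δ (r , t) (suc i) zero    = refl
symmetric-sym δ (r , t) (suc i) (suc j) = symmetric-sym _ t i j

symmetric-diag : ∀ {q} δ (t : Triangle q) i → symmetric δ t i i ≡ δ i
symmetric-diag δ (r , t) zero    = refl
symmetric-diag δ (r , t) (suc i) = symmetric-diag _ t i

symmetric-upper : ∀ {q} (f : Fin q → Fin q → Bool) δ → (∀ i j → f i j ≡ f j i) → (∀ i → f i i ≡ δ i) →
                  ∀ i j → symmetric δ (upper f) i j ≡ f i j
symmetric-upper f δ f-sym f-diag zero    zero    = sym (f-diag zero)
symmetric-upper f δ f-sym f-diag zero    (suc j) = lookup∘tabulate _ j
symmetric-upper f δ f-sym f-diag (suc i) zero    = trans (lookup∘tabulate _ i) (f-sym zero (suc i))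
symmetric-upper f δ f-sym f-diag (suc i) (suc j) =
  symmetric-upper _ _ (λ i j → f-sym (suc i) (suc j)) (λ i → f-diag (suc i)) i j

upper-symmetric : ∀ {q} (f : Fin q → Fin q → Bool) δ (t : Triangle q) →
                  (∀ i j → f i j ≡ symmetric δ t i j) → upper f ≡ t
upper-symmetric {zero}  f δ tt      f≡ = refl
upper-symmetric {suc q} f δ (r , t) f≡ =
  cong₂ _,_ (trans (tabulate-cong (λ j → f≡ zero (suc j))) (tabulate∘lookup r))
            (upper-symmetric _ _ t (λ i j → f≡ (suc i) (suc j)))

adj-tabulate : ∀ {n} (g : Fin n → Fin n → Bool) u v →
               adj (tabulate λ u → tabulate λ v → g u v) u v ≡ g u v
adj-tabulate g u v = trans (cong (λ r → lookup r v) (lookup∘tabulate _ u)) (lookup∘tabulate _ v)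

matrix-ext : ∀ {n} (M N : Matrix n) → (∀ u v → adj M u v ≡ adj N u v) → M ≡ N
matrix-ext M N M≗N = begin
  M                                            ≡⟨ sym (tabulate∘lookup M) ⟩
  tabulate (λ u → lookup M u)                  ≡⟨ tabulate-cong row≡ ⟩
  tabulate (λ u → lookup N u)                  ≡⟨ tabulate∘lookup N ⟩
  N                                            ∎
  where
  row≡ : ∀ u → lookup M u ≡ lookup N u
  row≡ u = trans (sym (tabulate∘lookup (lookup M u)))
                 (trans (tabulate-cong (M≗N u)) (tabulate∘lookup (lookup N u)))

by-blocks : ∀ {q} (P : Fin (q + q) → Fin (q + q) → Set) →
            (∀ i j → P (v₁ i) (v₁ j)) → (∀ i j → P (v₁ i) (v₂ j)) →
            (∀ i j → P (v₂ i) (v₁ j)) → (∀ i j → P (v₂ i) (v₂ j)) → ∀ u v → P u v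
by-blocks {q} P P₁₁ P₁₂ P₂₁ P₂₂ u v =
  subst₂ P (join-splitAt q q u) (join-splitAt q q v) (onJoin (splitAt q u) (splitAt q v))
  where
  onJoin : ∀ a b → P (join q q a) (join q q b)
  onJoin (inj₁ i) (inj₁ j) = P₁₁ i j
  onJoin (inj₁ i) (inj₂ j) = P₁₂ i j
  onJoin (inj₂ i) (inj₁ j) = P₂₁ i j
  onJoin (inj₂ i) (inj₂ j) = P₂₂ i j

module _ {q} (M : Matrix (q + q)) where

  τadj-v₁v₁ : ∀ i j → τadj {q} M (v₁ i) (v₁ j) ≡ adj M (v₁ i) (v₁ j)
  τadj-v₁v₁ i j rewrite splitAt-↑ˡ q i q | splitAt-↑ˡ q j q = refl

  τadj-v₂v₂ : ∀ i j → τadj {q} M (v₂ i) (v₂ j) ≡ adj M (v₂ i) (v₂ j)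
  τadj-v₂v₂ i j rewrite splitAt-↑ʳ q q i | splitAt-↑ʳ q q j = refl

  τadj-v₁v₂ : ∀ i j → τadj {q} M (v₁ i) (v₂ j) ≡ adj M (v₁ j) (v₂ i)
  τadj-v₁v₂ i j rewrite splitAt-↑ˡ q i q | splitAt-↑ʳ q q j with i ≟ j
  ... | yes refl = refl
  ... | no _     = refl

  τadj-v₂v₁ : ∀ i j → τadj {q} M (v₂ j) (v₁ i) ≡ adj M (v₂ i) (v₁ j)
  τadj-v₂v₁ i j rewrite splitAt-↑ʳ q q j | splitAt-↑ˡ q i q with i ≟ j
  ... | yes refl = refl
  ... | no _     = refl

CrossSymmetric : ∀ {q} → Matrix (q + q) → Set
CrossSymmetric {q} M = (∀ i j → adj M (v₁ {q} i) (v₂ {q} j) ≡ adj M (v₁ j) (v₂ i))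
                     × (∀ i j → adj M (v₂ {q} i) (v₁ {q} j) ≡ adj M (v₂ j) (v₁ i))

partiallySymmetric⇔crossSymmetric : ∀ {q} (M : Matrix (q + q)) → PartiallySymmetric q M ⇔ CrossSymmetric M
partiallySymmetric⇔crossSymmetric {q} M = mk⇔ toCross fromCross
  where
  adj-τ : ∀ u v → adj (partialTranspose {q} M) u v ≡ τadj {q} M u v
  adj-τ = adj-tabulate (τadj {q} M)

  toCross : PartiallySymmetric q M → CrossSymmetric M
  toCross M≡Mτ = (λ i j → trans (entry (v₁ i) (v₂ j)) (τadj-v₁v₂ M i j))
               , (λ i j → trans (entry (v₂ i) (v₁ j)) (τadj-v₂v₁ M j i))
    where
    entry : ∀ u v → adj M u v ≡ τadj {q} M u v
    entry u v = trans (cong (λ N → adj N u v) M≡Mτ) (adj-τ u v)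

  fromCross : CrossSymmetric M → PartiallySymmetric q M
  fromCross (cross₁₂ , cross₂₁) = matrix-ext M (partialTranspose {q} M) λ u v →
    trans (by-blocks {q} (λ u v → adj M u v ≡ τadj {q} M u v)
             (λ i j → sym (τadj-v₁v₁ M i j))
             (λ i j → trans (cross₁₂ i j) (sym (τadj-v₁v₂ M i j)))
             (λ i j → trans (cross₂₁ i j) (sym (τadj-v₂v₁ M j i)))
             (λ i j → sym (τadj-v₂v₂ M i j)) u v)
          (sym (adj-τ u v))

-- Parameters of a partially symmetric graph: the strict upper triangles of the
-- loopless blocks on C₁ and C₂, and the diagonal and upper triangle of the
-- symmetric cross block.
Param : ℕ → Set
Param q = Triangle q × Triangle q × Vec Bool q × Triangle q

loopless : ∀ {q} → Triangle q → Fin q → Fin q → Bool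
loopless = symmetric (λ _ → false)

block : ∀ {q} → Param q → Fin q ⊎ Fin q → Fin q ⊎ Fin q → Bool
block (A , B , d , X) (inj₁ i) (inj₁ j) = loopless A i j
block (A , B , d , X) (inj₂ i) (inj₂ j) = loopless B i j
block (A , B , d , X) (inj₁ i) (inj₂ j) = symmetric (lookup d) X i j
block (A , B , d , X) (inj₂ i) (inj₁ j) = symmetric (lookup d) X j i

block-sym : ∀ {q} (p : Param q) a b → block p a b ≡ block p b a
block-sym (A , B , d , X) (inj₁ i) (inj₁ j) = symmetric-sym _ A i j
block-sym (A , B , d , X) (inj₂ i) (inj₂ j) = symmetric-sym _ B i j
block-sym (A , B , d , X) (inj₁ i) (inj₂ j) = refl
block-sym (A , B , d , X) (inj₂ i) (inj₁ j) = refl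

block-diag : ∀ {q} (p : Param q) a → block p a a ≡ false
block-diag (A , B , d , X) (inj₁ i) = symmetric-diag _ A i
block-diag (A , B , d , X) (inj₂ i) = symmetric-diag _ B i

build : ∀ {q} → Param q → Matrix (q + q)
build {q} p = tabulate λ u → tabulate λ v → block p (splitAt q u) (splitAt q v)

adj-build : ∀ {q} (p : Param q) u v → adj (build p) u v ≡ block p (splitAt q u) (splitAt q v)
adj-build {q} p = adj-tabulate (λ u v → block p (splitAt q u) (splitAt q v))

adj-build-join : ∀ {q} (p : Param q) a b → adj (build p) (join q q a) (join q q b) ≡ block p a b
adj-build-join {q} p a b = trans (adj-build p (join q q a) (join q q b))
                                 (cong₂ (block p) (splitAt-join q q a) (splitAt-join q q b))

build-isPSGraph : ∀ {q} (p : Param q) → IsPSGraph q (build p)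
build-isPSGraph {q} p@(A , B , d , X) = (build-sym , build-loopless) , build-ps
  where
  build-sym : ∀ u v → adj (build p) u v ≡ adj (build p) v u
  build-sym u v = trans (adj-build p u v)
                        (trans (block-sym p (splitAt q u) (splitAt q v)) (sym (adj-build p v u)))

  build-loopless : ∀ u → adj (build p) u u ≡ false
  build-loopless u = trans (adj-build p u u) (block-diag p (splitAt q u))

  cross : ∀ i j → adj (build p) (v₁ i) (v₂ j) ≡ adj (build p) (v₁ j) (v₂ i)
  cross i j = trans (adj-build-join p (inj₁ i) (inj₂ j))
                    (trans (symmetric-sym _ X i j) (sym (adj-build-join p (inj₁ j) (inj₂ i))))

  build-ps : PartiallySymmetric q (build p)
  build-ps = Equivalence.from (partiallySymmetric⇔crossSymmetric (build p))
               (cross , λ i j → trans (build-sym (v₂ i) (v₁ j)) (trans (cross j i) (build-sym (v₁ i) (v₂ j))))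

extract : ∀ {q} → Matrix (q + q) → Param q
extract {q} M = upper (λ i j → adj M (v₁ {q} i) (v₁ {q} j))
              , upper (λ i j → adj M (v₂ {q} i) (v₂ {q} j))
              , tabulate (λ i → adj M (v₁ {q} i) (v₂ {q} i))
              , upper (λ i j → adj M (v₁ {q} i) (v₂ {q} j))

extract-build : ∀ {q} (p : Param q) → extract (build p) ≡ p
extract-build {q} p@(A , B , d , X) =
  cong₂ _,_ (upper-symmetric _ _ A (λ i j → adj-build-join p (inj₁ i) (inj₁ j)))
  (cong₂ _,_ (upper-symmetric _ _ B (λ i j → adj-build-join p (inj₂ i) (inj₂ j)))
  (cong₂ _,_ (trans (tabulate-cong (λ i → trans (adj-build-join p (inj₁ i) (inj₂ i)) (symmetric-diag _ X i)))
                    (tabulate∘lookup d))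
             (upper-symmetric _ _ X (λ i j → adj-build-join p (inj₁ i) (inj₂ j)))))

build-extract : ∀ {q} (M : Matrix (q + q)) → IsPSGraph q M → build {q} (extract {q} M) ≡ M
build-extract {q} M ((M-sym , M-loopless) , M-ps) = matrix-ext (build p) M
  (by-blocks {q} (λ u v → adj (build p) u v ≡ adj M u v)
    (λ i j → trans (adj-build-join p (inj₁ i) (inj₁ j))
                   (symmetric-upper _ _ (λ _ _ → M-sym _ _) (λ _ → M-loopless _) i j))
    (λ i j → trans (adj-build-join p (inj₁ i) (inj₂ j)) (cross i j))
    (λ i j → trans (adj-build-join p (inj₂ i) (inj₁ j)) (trans (cross j i) (M-sym (v₁ j) (v₂ i))))
    (λ i j → trans (adj-build-join p (inj₂ i) (inj₂ j))
                   (symmetric-upper _ _ (λ _ _ → M-sym _ _) (λ _ → M-loopless _) i j)))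
  where
  p = extract {q} M
  cross : ∀ i j → symmetric (lookup (tabulate (λ k → adj M (v₁ {q} k) (v₂ {q} k))))
                            (upper (λ k l → adj M (v₁ {q} k) (v₂ {q} l))) i j
                  ≡ adj M (v₁ i) (v₂ j)
  cross = symmetric-upper _ _ (proj₁ (Equivalence.to (partiallySymmetric⇔crossSymmetric M) M-ps))
                              (λ i → sym (lookup∘tabulate _ i))

enumParam : ∀ q → Enum (Param q) (2 ^ (triangle q + (triangle q + (q + triangle q))))
enumParam q = enumBits× t (t + (q + t)) (enumTriangle q)
                (enumBits× t (q + t) (enumTriangle q)
                  (enumBits× q t (enumVec enumBool q) (enumTriangle q)))
  where t = triangle q

square-step : ∀ n t → t + t + n ≡ n * n → (n + t) + (n + t) + suc n ≡ suc n * suc n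
square-step n t hyp = begin
  (n + t) + (n + t) + suc n   ≡⟨ regroup n t ⟩
  (t + t + n) + 2 * n + 1     ≡⟨ cong (λ x → x + 2 * n + 1) hyp ⟩
  n * n + 2 * n + 1           ≡⟨ expand n ⟩
  suc n * suc n               ∎
  where
  regroup : ∀ n t → (n + t) + (n + t) + suc n ≡ (t + t + n) + 2 * n + 1
  regroup = solve-∀
  expand : ∀ n → n * n + 2 * n + 1 ≡ suc n * suc n
  expand = solve-∀

twice-triangle : ∀ q → triangle q + triangle q + q ≡ q * q
twice-triangle zero    = refl
twice-triangle (suc n) = square-step n (triangle n) (twice-triangle n)

three-halves : ∀ q t → t + t + q ≡ q * q → q * (3 * q ∸ 1) ≡ (t + (t + (q + t))) * 2
three-halves q t hyp = begin
  q * (3 * q ∸ 1)                  ≡⟨ *-distribˡ-∸ q (3 * q) 1 ⟩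
  q * (3 * q) ∸ q * 1              ≡⟨ cong₂ _∸_ (commute q) (*-identityʳ q) ⟩
  3 * (q * q) ∸ q                  ≡⟨ cong (λ x → 3 * x ∸ q) (sym hyp) ⟩
  3 * (t + t + q) ∸ q              ≡⟨ cong (_∸ q) (regroup q t) ⟩
  (t + (t + (q + t))) * 2 + q ∸ q  ≡⟨ m+n∸n≡m ((t + (t + (q + t))) * 2) q ⟩
  (t + (t + (q + t))) * 2          ∎
  where
  commute : ∀ q → q * (3 * q) ≡ 3 * (q * q)
  commute = solve-∀
  regroup : ∀ q t → 3 * (t + t + q) ≡ (t + (t + (q + t))) * 2 + q
  regroup = solve-∀

parameter-count : ∀ q → (q * (3 * q ∸ 1)) / 2 ≡ triangle q + (triangle q + (q + triangle q))
parameter-count q = trans (cong (_/ 2) (three-halves q t (twice-triangle q))) (m*n/n≡m (t + (t + (q + t))) 2)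
  where t = triangle q

lemma1 : (q : ℕ) →
    Σ (List (Matrix (q + q))) λ L →
      Unique L × (∀ M → IsPSGraph q M ⇔ (M ∈ L)) × (length L ≡ 2 ^ ((q * (3 * q ∸ 1)) / 2))
lemma1 q with listImage (IsPSGraph q) (enumParam q) (build {q}) (extract {q})
                  (extract-build {q}) (build-isPSGraph {q}) (build-extract {q})
... | L , L-unique , L-members , L-size =
  L , L-unique , L-members , trans L-size (cong (2 ^_) (sym (parameter-count q)))
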